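{- Let $m\ge 2$ and $G_m=K_{2m}\Box K_{2m}$. Then every fort of $G_m$ contains at least $4$ vertices, and $\operatorname{ft}(G_m)=\operatorname{ft}(K_{2m})\operatorname{ft}(K_{2m})$.
   Context: All graphs are finite, simple and undirected. $K_n$ is the complete graph on $n$ vertices. A fort of $G$ is a nonempty $F\subseteq V(G)$ such that every $v\in V(G)\setminus F$ has $|N_G(v)\cap F|\neq 1$. The fort number $\operatorname{ft}(G)$ is the maximum number of forts in a collection of pairwise disjoint forts of $G$. The Cartesian product $G\Box G'$ has vertex set $V(G)\times V(G')$, with $(u,u')\sim(v,v')$ iff ($u=v$ and $u'v'\in E(G')$) or ($u'=v'$ and $uv\in E(G)$). -}

module Defs where

open import Data.Nat using (ℕ; _*_; _≤_)
open import Data.Bool using (Bool; true; false; _∧_; _∨_; not; if_then_else_)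
open import Data.Empty using (⊥-elim)
open import Data.Fin using (Fin; remQuot)
open import Data.Fin.Properties using (_≟_)
open import Data.Fin.Subset using (Subset; _∉_; _∩_; ⊥; Nonempty)
open import Data.Vec using (lookup)
open import Data.List using (List; length; map; allFin)
open import Data.Nat.ListAction using (sum)
open import Data.List.Relation.Unary.All using (All)
open import Data.List.Relation.Unary.AllPairs using (AllPairs)
open import Data.Product using (_×_; _,_; proj₁; proj₂; ∃)
open import Relation.Binary.PropositionalEquality using (_≡_; refl; sym; cong; cong₂)
open import Relation.Nullary using (¬_; yes; no)
open import Relation.Nullary.Decidable using (⌊_⌋)

record Graph : Set where
  field
    n       : ℕ
    adj     : Fin n → Fin n → Bool
    adj-sym : ∀ u v → adj u v ≡ adj v u
    adj-irr : ∀ v → adj v v ≡ false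
open Graph public

eqB : ∀ {k} → Fin k → Fin k → Bool
eqB x y = ⌊ x ≟ y ⌋

eqB-sym : ∀ {k} (x y : Fin k) → eqB x y ≡ eqB y x
eqB-sym x y with x ≟ y | y ≟ x
... | yes _ | yes _ = refl
... | no _  | no _  = refl
... | yes p | no q  = ⊥-elim (q (sym p))
... | no p  | yes q = ⊥-elim (p (sym q))

eqB-refl : ∀ {k} (x : Fin k) → eqB x x ≡ true
eqB-refl x with x ≟ x
... | yes _ = refl
... | no p  = ⊥-elim (p refl)

K : ℕ → Graph
K k = record
  { n = k
  ; adj = λ u v → not (eqB u v)
  ; adj-sym = λ u v → cong not (eqB-sym u v)
  ; adj-irr = λ v → cong not (eqB-refl v) }

-- Cartesian product G □ H.  Vertex (u,u') ∈ V(G)×V(H) is encoded in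
-- Fin (n G * n H) and decoded with remQuot (inverse of Data.Fin.combine).
prodAdj : (G H : Graph) → Fin (n G) × Fin (n H) → Fin (n G) × Fin (n H) → Bool
prodAdj G H (u , u') (v , v') =
  (eqB u v ∧ adj H u' v') ∨ (eqB u' v' ∧ adj G u v)

prodAdj-sym : (G H : Graph) → ∀ p q → prodAdj G H p q ≡ prodAdj G H q p
prodAdj-sym G H (u , u') (v , v') =
  cong₂ _∨_ (cong₂ _∧_ (eqB-sym u v) (adj-sym H u' v'))
            (cong₂ _∧_ (eqB-sym u' v') (adj-sym G u v))

prodAdj-irr : (G H : Graph) → ∀ p → prodAdj G H p p ≡ false
prodAdj-irr G H (u , u')
  rewrite eqB-refl u | eqB-refl u' | adj-irr H u' | adj-irr G u = refl

_□_ : Graph → Graph → Graph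
G □ H = record
  { n = n G * n H
  ; adj = a
  ; adj-sym = s
  ; adj-irr = ir }
  where
  a : Fin (n G * n H) → Fin (n G * n H) → Bool
  a x y = prodAdj G H (remQuot (n H) x) (remQuot (n H) y)
  s : ∀ x y → a x y ≡ a y x
  s x y = prodAdj-sym G H (remQuot (n H) x) (remQuot (n H) y)
  ir : ∀ x → a x x ≡ false
  ir x = prodAdj-irr G H (remQuot (n H) x)

nbrCount : (G : Graph) → Subset (n G) → Fin (n G) → ℕ
nbrCount G F v =
  sum (map (λ u → if adj G v u ∧ lookup F u then 1 else 0) (allFin (n G)))

IsFort : (G : Graph) → Subset (n G) → Set
IsFort G F = Nonempty F × (∀ v → v ∉ F → ¬ (nbrCount G F v ≡ 1))

Disjoint : ∀ {k} → Subset k → Subset k → Set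
Disjoint F F' = F ∩ F' ≡ ⊥

DisjointForts : (G : Graph) → List (Subset (n G)) → Set
DisjointForts G Fs = All (IsFort G) Fs × AllPairs Disjoint Fs

IsFortNumber : Graph → ℕ → Set
IsFortNumber G k =
  (∃ λ Fs → DisjointForts G Fs × length Fs ≡ k)
  × (∀ Fs → DisjointForts G Fs → length Fs ≤ k)

-- A vertex outside a fort that has one neighbour in the fort must have a second one.  In K N this
-- forces every fort to have at least two vertices, so K (2m) has m disjoint pair forts and no more.
-- In the rook's graph K N □ K N, take a fort vertex (a, b).  If it is alone in its row, then for
-- every other column c the vertex (a, c) lies outside the fort and sees (a, b), so its second fort
-- neighbour lies in column c: the fort meets all N columns.  Applying this (or its transpose) three
-- times, either the fort has N ≥ 4 vertices or (a, b) has a row-mate (a, b′) and a column-mate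
-- (a′, b), which has a row-mate (a′, b″); these are four vertices.  Products of forts are forts of
-- the Cartesian product, so the m² products of the pairs are disjoint forts, and no more fit into
-- the 4m² vertices when each needs four.

module Submission where

open import Defs
open import Data.Nat using (ℕ; zero; suc; _+_; _*_; _≤_; z≤n; s≤s; NonZero)
open import Data.Nat.Properties
  using (≤-refl; ≤-reflexive; ≤-trans; ≤-antisym; +-suc; +-mono-≤; *-suc; *-zeroʳ; *-cancelˡ-≤; *-monoʳ-≤;
         m≤m+n; module ≤-Reasoning)
open import Data.Bool using (Bool; true; false; _∧_; not; if_then_else_)
import Data.Bool as Bool
open import Data.Bool.Properties using (∧-conicalˡ; ∧-conicalʳ; ∨-zeroʳ)
open import Data.Fin using (Fin; combine; remQuot; punchIn)
import Data.Fin as Fin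
open import Data.Fin.Properties
  using (_≟_; any?; combine-remQuot; remQuot-combine; combine-injectiveˡ; combine-injectiveʳ; punchInᵢ≢i)
open import Data.Fin.Subset using (Subset; inside; outside; _∈_; _∉_; ∣_∣; _∩_; _∪_; ⊥; ⋃; ⁅_⁆; Nonempty)
open import Data.Fin.Subset.Properties
  using (∣⊥∣≡0; ∣⁅x⁆∣≡1; x∈⁅x⁆; p⊆q⇒∣p∣≤∣q∣; x∈p⇒∣p-x∣<∣p∣; x∈p∧x≢y⇒x∈p-y;
         nonempty?; _∈?_; ∣p∣≤n; Empty-unique; ∉⊥; x∈p∩q⁻; x∈p∩q⁺; ∩-distribˡ-∪; ∩-zeroʳ; ∪-identityˡ)
open import Data.Vec using ([]; _∷_; tabulate; tail; lookup)
open import Data.Vec.Properties using (lookup∘tabulate; lookup⇒[]=; []=⇒lookup)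
open import Data.List using (List; []; _∷_; length; cartesianProductWith)
import Data.List as List
open import Data.List.Properties using (length-tabulate; map-tabulate; length-++; length-map)
open import Data.Nat.ListAction using (sum)
open import Data.Nat.Tactic.RingSolver using (solve-∀)
open import Data.List.Relation.Unary.All as All using (All; []; _∷_)
import Data.List.Relation.Unary.All.Properties as All
import Data.List.Relation.Unary.Unique.Propositional.Properties as Unique
open import Data.List.Relation.Unary.AllPairs as AllPairs using (AllPairs; []; _∷_)
import Data.List.Relation.Unary.AllPairs.Properties as AllPairs
open import Data.List.Relation.Unary.Unique.Propositional using (Unique)
open import Data.Product using (_×_; _,_; ∃; proj₁; proj₂; uncurry)
import Data.Product as Product
open import Data.Sum using (_⊎_; inj₁; inj₂)
import Data.Sum as Sum
open import Function using (id; _∘_; flip)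
open import Relation.Binary.PropositionalEquality
import Relation.Binary.PropositionalEquality.Properties as ≡
open import Relation.Nullary using (¬_; yes; no; contradiction; ¬?; _×-dec_)
open import Relation.Nullary.Decidable using (decidable-stable)

private
  variable
    k : ℕ
    x : Fin k
    p q : Subset k

∈-tabulate⁺ : ∀ {f : Fin k → Bool} → f x ≡ true → x ∈ tabulate f
∈-tabulate⁺ {x = x} {f} fx = lookup⇒[]= x (tabulate f) (trans (lookup∘tabulate f x) fx)

∈-tabulate⁻ : ∀ {f : Fin k → Bool} → x ∈ tabulate f → f x ≡ true
∈-tabulate⁻ {x = x} {f} x∈ = trans (sym (lookup∘tabulate f x)) ([]=⇒lookup x∈)

length≤∣p∣ : ∀ {xs : List (Fin k)} → Unique xs → All (_∈ p) xs → length xs ≤ ∣ p ∣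
length≤∣p∣ [] [] = z≤n
length≤∣p∣ (x≢xs ∷ unique) (x∈p ∷ xs⊆p) =
  ≤-trans (s≤s (length≤∣p∣ unique (All.zipWith ∈p-x (xs⊆p , x≢xs)))) (x∈p⇒∣p-x∣<∣p∣ x∈p)
  where
  ∈p-x : ∀ {y} → y ∈ _ × _ ≢ y → y ∈ _
  ∈p-x (y∈p , x≢y) = x∈p∧x≢y⇒x∈p-y y∈p (≢-sym x≢y)

∣p∣≡1⇒∃! : ∣ p ∣ ≡ 1 → ∃ λ x → x ∈ p × ∀ {y} → y ∈ p → y ≡ x
∣p∣≡1⇒∃! {k} {p} ∣p∣≡1 with nonempty? p
... | no empty =
  contradiction (trans (sym (∣⊥∣≡0 k)) (trans (cong ∣_∣ (sym (Empty-unique empty))) ∣p∣≡1)) λ ()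
... | yes (x , x∈p) = x , x∈p , unique
  where
  unique : ∀ {y} → y ∈ p → y ≡ x
  unique {y} y∈p with y ≟ x
  ... | yes y≡x = y≡x
  ... | no y≢x = contradiction (subst (2 ≤_) ∣p∣≡1 (length≤∣p∣ ((y≢x ∷ []) ∷ [] ∷ []) (y∈p ∷ x∈p ∷ [])))
                               λ { (s≤s ()) }

∃!⇒∣p∣≡1 : x ∈ p → (∀ {y} → y ∈ p → y ≡ x) → ∣ p ∣ ≡ 1
∃!⇒∣p∣≡1 {x = x} x∈p unique = ≤-antisym
  (subst (_ ≤_) (∣⁅x⁆∣≡1 x) (p⊆q⇒∣p∣≤∣q∣ λ y∈p → subst (_∈ ⁅ x ⁆) (sym (unique y∈p)) (x∈⁅x⁆ x)))
  (length≤∣p∣ ([] ∷ []) (x∈p ∷ []))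

Disjoint⁺ : (∀ {x} → x ∈ p → x ∉ q) → Disjoint p q
Disjoint⁺ {p = p} {q} apart = Empty-unique λ (x , x∈p∩q) →
  let x∈p , x∈q = x∈p∩q⁻ p q x∈p∩q in apart x∈p x∈q

Disjoint⁻ : Disjoint p q → x ∈ p → x ∉ q
Disjoint⁻ {x = x} p∩q≡⊥ x∈p x∈q = ∉⊥ (subst (x ∈_) p∩q≡⊥ (x∈p∩q⁺ (x∈p , x∈q)))

Disjoint-⋃ : ∀ {qs} → All (Disjoint p) qs → Disjoint p (⋃ qs)
Disjoint-⋃ {p = p} [] = ∩-zeroʳ p
Disjoint-⋃ {p = p} {q ∷ qs} (p⟂q ∷ p⟂qs) = begin
  p ∩ (q ∪ ⋃ qs)         ≡⟨ ∩-distribˡ-∪ p q (⋃ qs) ⟩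
  (p ∩ q) ∪ (p ∩ ⋃ qs)   ≡⟨ cong₂ _∪_ p⟂q (Disjoint-⋃ p⟂qs) ⟩
  ⊥ ∪ ⊥                  ≡⟨ ∪-identityˡ ⊥ ⟩
  ⊥                      ∎
  where open ≡-Reasoning

∣p∪q∣≡∣p∣+∣q∣ : Disjoint p q → ∣ p ∪ q ∣ ≡ ∣ p ∣ + ∣ q ∣
∣p∪q∣≡∣p∣+∣q∣ {p = []}          {[]}          _ = refl
∣p∪q∣≡∣p∣+∣q∣ {p = inside  ∷ p} {inside  ∷ q} ()
∣p∪q∣≡∣p∣+∣q∣ {p = inside  ∷ p} {outside ∷ q} d = cong suc (∣p∪q∣≡∣p∣+∣q∣ (cong tail d))
∣p∪q∣≡∣p∣+∣q∣ {p = outside ∷ p} {inside  ∷ q} d =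
  trans (cong suc (∣p∪q∣≡∣p∣+∣q∣ (cong tail d))) (sym (+-suc ∣ p ∣ ∣ q ∣))
∣p∪q∣≡∣p∣+∣q∣ {p = outside ∷ p} {outside ∷ q} d = ∣p∪q∣≡∣p∣+∣q∣ (cong tail d)

*-length≤∣⋃∣ : ∀ c {Fs : List (Subset k)} → All (λ F → c ≤ ∣ F ∣) Fs → AllPairs Disjoint Fs →
               c * length Fs ≤ ∣ ⋃ Fs ∣
*-length≤∣⋃∣ {k} c [] [] = ≤-reflexive (trans (*-zeroʳ c) (sym (∣⊥∣≡0 k)))
*-length≤∣⋃∣ c {F ∷ Fs} (c≤∣F∣ ∷ large) (F⟂Fs ∷ disjoint) = begin
  c * suc (length Fs)     ≡⟨ *-suc c (length Fs) ⟩
  c + c * length Fs       ≤⟨ +-mono-≤ c≤∣F∣ (*-length≤∣⋃∣ c large disjoint) ⟩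
  ∣ F ∣ + ∣ ⋃ Fs ∣        ≡⟨ ∣p∪q∣≡∣p∣+∣q∣ (Disjoint-⋃ F⟂Fs) ⟨
  ∣ F ∪ ⋃ Fs ∣            ∎
  where open ≤-Reasoning

injection⇒≤∣p∣ : ∀ {l} (f : Fin l → Fin k) → (∀ {i j} → f i ≡ f j → i ≡ j) → (∀ i → f i ∈ p) →
                 l ≤ ∣ p ∣
injection⇒≤∣p∣ f injective f∈p =
  subst (_≤ _) (length-tabulate f) (length≤∣p∣ (Unique.tabulate⁺ injective) (All.tabulate⁺ f∈p))

-- Graphs

eqB-true⁻ : ∀ {x y : Fin k} → eqB x y ≡ true → x ≡ y
eqB-true⁻ {x = x} {y} eq with x ≟ y
... | yes x≡y = x≡y
eqB-true⁻ () | no _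

eqB-false : ∀ {x y : Fin k} → x ≢ y → eqB x y ≡ false
eqB-false {x = x} {y} x≢y with x ≟ y
... | yes x≡y = contradiction x≡y x≢y
... | no _    = refl

Adj : (G : Graph) → Fin (n G) → Fin (n G) → Set
Adj G u v = adj G u v ≡ true

neighboursIn : (G : Graph) → Subset (n G) → Fin (n G) → Subset (n G)
neighboursIn G F v = tabulate λ u → adj G v u ∧ lookup F u

sum-indicators≡∣tabulate∣ : (f : Fin k → Bool) →
  sum (List.tabulate λ u → if f u then 1 else 0) ≡ ∣ tabulate f ∣
sum-indicators≡∣tabulate∣ {zero}  f = refl
sum-indicators≡∣tabulate∣ {suc k} f with f Fin.zero
... | true  = cong suc (sum-indicators≡∣tabulate∣ (f ∘ Fin.suc))
... | false = sum-indicators≡∣tabulate∣ (f ∘ Fin.suc)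

nbrCount≡∣neighboursIn∣ : ∀ G F v → nbrCount G F v ≡ ∣ neighboursIn G F v ∣
nbrCount≡∣neighboursIn∣ G F v = trans (cong sum (map-tabulate {n = n G} id _))
                                      (sum-indicators≡∣tabulate∣ λ u → adj G v u ∧ lookup F u)

UniqueNeighbourIn : (G : Graph) → Subset (n G) → Fin (n G) → Fin (n G) → Set
UniqueNeighbourIn G F v u = u ∈ F × Adj G v u × (∀ {w} → w ∈ F → Adj G v w → w ≡ u)

module _ {G : Graph} {F : Subset (n G)} where

  ∈-neighboursIn⁺ : ∀ {v u} → Adj G v u → u ∈ F → u ∈ neighboursIn G F v
  ∈-neighboursIn⁺ v∼u u∈F = ∈-tabulate⁺ (cong₂ _∧_ v∼u ([]=⇒lookup u∈F))

  ∈-neighboursIn⁻ : ∀ {v u} → u ∈ neighboursIn G F v → Adj G v u × u ∈ F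
  ∈-neighboursIn⁻ {v} {u} u∈N =
    ∧-conicalˡ _ _ (∈-tabulate⁻ u∈N) , lookup⇒[]= u F (∧-conicalʳ (adj G v u) _ (∈-tabulate⁻ u∈N))

  nbrCount≡1⇒UniqueNeighbourIn : ∀ {v} → nbrCount G F v ≡ 1 → ∃ (UniqueNeighbourIn G F v)
  nbrCount≡1⇒UniqueNeighbourIn {v} count≡1 =
    let u , u∈N , unique = ∣p∣≡1⇒∃! (trans (sym (nbrCount≡∣neighboursIn∣ G F v)) count≡1)
        v∼u , u∈F = ∈-neighboursIn⁻ u∈N
    in u , u∈F , v∼u , λ w∈F v∼w → unique (∈-neighboursIn⁺ {v} v∼w w∈F)

  UniqueNeighbourIn⇒nbrCount≡1 : ∀ {v u} → UniqueNeighbourIn G F v u → nbrCount G F v ≡ 1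
  UniqueNeighbourIn⇒nbrCount≡1 {v} (u∈F , v∼u , unique) =
    trans (nbrCount≡∣neighboursIn∣ G F v) (∃!⇒∣p∣≡1 (∈-neighboursIn⁺ {v} v∼u u∈F) λ w∈N →
      let v∼w , w∈F = ∈-neighboursIn⁻ w∈N in unique w∈F v∼w)

  fort-intro : Nonempty F → (∀ {v u} → v ∉ F → ¬ UniqueNeighbourIn G F v u) → IsFort G F
  fort-intro nonempty noUnique = nonempty , λ v v∉F count≡1 →
    noUnique v∉F (proj₂ (nbrCount≡1⇒UniqueNeighbourIn {v} count≡1))

  fort⇒¬UniqueNeighbourIn : IsFort G F → ∀ {v u} → v ∉ F → ¬ UniqueNeighbourIn G F v u
  fort⇒¬UniqueNeighbourIn (_ , fort) {v} v∉F unique =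
    fort v v∉F (UniqueNeighbourIn⇒nbrCount≡1 {v} unique)

  fort⇒secondNeighbour : IsFort G F → ∀ {v u} → v ∉ F → u ∈ F → Adj G v u →
                         ∃ λ w → w ∈ F × Adj G v w × w ≢ u
  fort⇒secondNeighbour fort {v} {u} v∉F u∈F v∼u
    with any? (λ w → (w ∈? F) ×-dec (adj G v w Bool.≟ true) ×-dec ¬? (w ≟ u))
  ... | yes second = second
  ... | no noSecond =
    contradiction (u∈F , v∼u , λ {w} → onlyNeighbour {w}) (fort⇒¬UniqueNeighbourIn fort v∉F)
    where
    onlyNeighbour : ∀ {w} → w ∈ F → Adj G v w → w ≡ u
    onlyNeighbour {w} w∈F v∼w = decidable-stable (w ≟ u) λ w≢u → noSecond (w , w∈F , v∼w , w≢u)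

IsFortNumber-intro : ∀ {G} c .{{_ : NonZero c}} {k} Fs → (∀ F → IsFort G F → c ≤ ∣ F ∣) →
                     n G ≤ c * k → DisjointForts G Fs → length Fs ≡ k → IsFortNumber G k
IsFortNumber-intro {G} c Fs large n≤c*k disjointForts length≡k =
  (Fs , disjointForts , length≡k) , maximal
  where
  maximal : ∀ Fs′ → DisjointForts G Fs′ → length Fs′ ≤ _
  maximal Fs′ (forts , disjoint) = *-cancelˡ-≤ c (≤-trans
    (≤-trans (*-length≤∣⋃∣ c (All.map (λ {F} → large F) forts) disjoint) (∣p∣≤n (⋃ Fs′))) n≤c*k)

-- Cartesian products

data Coordinates {k l : ℕ} : Fin (k * l) → Set where
  coords : (a : Fin k) (b : Fin l) → Coordinates (combine a b)

coordinates : ∀ {k l} (x : Fin (k * l)) → Coordinates x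
coordinates {k} {l} x =
  subst Coordinates (combine-remQuot {k} l x)
                    (coords (proj₁ (remQuot {k} l x)) (proj₂ (remQuot {k} l x)))

module _ {G H : Graph} where

  adj-□ : ∀ a b c d → adj (G □ H) (combine a b) (combine c d) ≡ prodAdj G H (a , b) (c , d)
  adj-□ a b c d = cong₂ (prodAdj G H) (remQuot-combine a b) (remQuot-combine c d)

  Adj-□⁻ : ∀ {a b c d} → Adj (G □ H) (combine a b) (combine c d) →
           (a ≡ c × Adj H b d) ⊎ (b ≡ d × Adj G a c)
  Adj-□⁻ {a} {b} {c} {d} a,b∼c,d
    with eqB a c ∧ adj H b d in row | trans (sym (adj-□ a b c d)) a,b∼c,d
  ... | true  | _ = inj₁ (eqB-true⁻ (∧-conicalˡ _ _ row) , ∧-conicalʳ (eqB a c) _ row)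
  ... | false | column = inj₂ (eqB-true⁻ (∧-conicalˡ _ _ column) , ∧-conicalʳ (eqB b d) _ column)

  Adj-□⁺ʳ : ∀ {a b d} → Adj H b d → Adj (G □ H) (combine a b) (combine a d)
  Adj-□⁺ʳ {a} {b} {d} b∼d rewrite adj-□ a b a d | eqB-refl a | b∼d = refl

  Adj-□⁺ˡ : ∀ {a b c} → Adj G a c → Adj (G □ H) (combine a b) (combine c b)
  Adj-□⁺ˡ {a} {b} {c} a∼c rewrite adj-□ a b c b | eqB-refl b | a∼c = ∨-zeroʳ _

_⊠_ : ∀ {k l} → Subset k → Subset l → Subset (k * l)
_⊠_ {l = l} F F′ = tabulate λ x → uncurry (λ a b → lookup F a ∧ lookup F′ b) (remQuot l x)

module _ {k l} {F : Subset k} {F′ : Subset l} where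

  ∈-⊠⁺ : ∀ {a b} → a ∈ F → b ∈ F′ → combine a b ∈ F ⊠ F′
  ∈-⊠⁺ {a} {b} a∈F b∈F′ = ∈-tabulate⁺
    (trans (cong (uncurry λ a b → lookup F a ∧ lookup F′ b) (remQuot-combine a b))
           (cong₂ _∧_ ([]=⇒lookup a∈F) ([]=⇒lookup b∈F′)))

  ∈-⊠⁻ : ∀ {a b} → combine a b ∈ F ⊠ F′ → a ∈ F × b ∈ F′
  ∈-⊠⁻ {a} {b} ab∈ =
    let both = trans (sym (cong (uncurry λ a b → lookup F a ∧ lookup F′ b) (remQuot-combine a b)))
                     (∈-tabulate⁻ ab∈)
    in lookup⇒[]= a F (∧-conicalˡ _ _ both) , lookup⇒[]= b F′ (∧-conicalʳ (lookup F a) _ both)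

module _ {G H : Graph} {F : Subset (n G)} {F′ : Subset (n H)} where

  ⊠-fort : IsFort G F → IsFort H F′ → IsFort (G □ H) (F ⊠ F′)
  ⊠-fort fort@((x , x∈F) , _) fort′@((y , y∈F′) , _) =
    fort-intro {G □ H} (combine x y , ∈-⊠⁺ x∈F y∈F′) noUniqueNeighbour
    where
    -- A unique neighbour of (a, b) in F ⊠ F′ within row a would be a unique neighbour of b in F′.
    noUniqueNeighbour : ∀ {v u} → v ∉ F ⊠ F′ → ¬ UniqueNeighbourIn (G □ H) (F ⊠ F′) v u
    noUniqueNeighbour {v} {u} v∉ (u∈ , v∼u , unique)
      with coordinates {n G} {n H} v | coordinates {n G} {n H} u
    ... | coords a b | coords c d with Adj-□⁻ {G} {H} v∼u | ∈-⊠⁻ u∈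
    ... | inj₁ (refl , b∼d) | a∈F , d∈F′ =
      fort⇒¬UniqueNeighbourIn {H} fort′ (λ b∈F′ → v∉ (∈-⊠⁺ a∈F b∈F′))
        (d∈F′ , b∼d , λ e∈F′ b∼e →
          combine-injectiveʳ a _ a d (unique (∈-⊠⁺ a∈F e∈F′) (Adj-□⁺ʳ {G} {H} b∼e)))
    ... | inj₂ (refl , a∼c) | c∈F , b∈F′ =
      fort⇒¬UniqueNeighbourIn {G} fort (λ a∈F → v∉ (∈-⊠⁺ a∈F b∈F′))
        (c∈F , a∼c , λ e∈F a∼e →
          combine-injectiveˡ _ b c b (unique (∈-⊠⁺ e∈F b∈F′) (Adj-□⁺ˡ {G} {H} a∼e)))

module _ {k l} {F₁ F₂ : Subset k} {F₁′ F₂′ : Subset l} where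

  ⊠-disjointˡ : Disjoint F₁ F₂ → Disjoint (F₁ ⊠ F₁′) (F₂ ⊠ F₂′)
  ⊠-disjointˡ F₁⟂F₂ = Disjoint⁺ apart
    where
    apart : ∀ {x} → x ∈ F₁ ⊠ F₁′ → x ∉ F₂ ⊠ F₂′
    apart {x} x∈₁ x∈₂ with coordinates {k} {l} x
    ... | coords a b =
      Disjoint⁻ F₁⟂F₂ (proj₁ (∈-⊠⁻ {F = F₁} {F₁′} x∈₁)) (proj₁ (∈-⊠⁻ {F = F₂} {F₂′} x∈₂))

  ⊠-disjointʳ : Disjoint F₁′ F₂′ → Disjoint (F₁ ⊠ F₁′) (F₂ ⊠ F₂′)
  ⊠-disjointʳ F₁′⟂F₂′ = Disjoint⁺ apart
    where
    apart : ∀ {x} → x ∈ F₁ ⊠ F₁′ → x ∉ F₂ ⊠ F₂′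
    apart {x} x∈₁ x∈₂ with coordinates {k} {l} x
    ... | coords a b =
      Disjoint⁻ F₁′⟂F₂′ (proj₂ (∈-⊠⁻ {F = F₁} {F₁′} x∈₁)) (proj₂ (∈-⊠⁻ {F = F₂} {F₂′} x∈₂))

AllPairs-cartesianProductWith⁺ :
  ∀ {A B C : Set} {R : A → A → Set} {S : B → B → Set} {T : C → C → Set} (f : A → B → C) →
  (∀ {x x′ y y′} → R x x′ → T (f x y) (f x′ y′)) → (∀ {x y y′} → S y y′ → T (f x y) (f x y′)) →
  ∀ {xs ys} → AllPairs R xs → AllPairs S ys → AllPairs T (cartesianProductWith f xs ys)
AllPairs-cartesianProductWith⁺ f apartˡ apartʳ [] _ = []
AllPairs-cartesianProductWith⁺ {R = R} {T = T} f apartˡ apartʳ {x ∷ xs} {ys} (Rx ∷ Rxs) Sys =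
  AllPairs.++⁺ (AllPairs.map⁺ (AllPairs.map apartʳ Sys))
               (AllPairs-cartesianProductWith⁺ f apartˡ apartʳ Rxs Sys)
               (All.map⁺ (All.universal (λ y → apartFromLater y Rx) ys))
  where
  apartFromLater : ∀ y {xs′} → All (R x) xs′ → All (T (f x y)) (cartesianProductWith f xs′ ys)
  apartFromLater y [] = []
  apartFromLater y (Rxx′ ∷ Rxxs′) =
    All.++⁺ (All.map⁺ (All.universal (λ _ → apartˡ Rxx′) ys)) (apartFromLater y Rxxs′)

length-cartesianProductWith : ∀ {A B C : Set} (f : A → B → C) xs ys →
                              length (cartesianProductWith f xs ys) ≡ length xs * length ys
length-cartesianProductWith f [] ys = refl
length-cartesianProductWith f (x ∷ xs) ys =
  trans (length-++ (List.map (f x) ys))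
        (cong₂ _+_ (length-map (f x) ys) (length-cartesianProductWith f xs ys))

DisjointForts-⊠ : ∀ {G H Fs Fs′} → DisjointForts G Fs → DisjointForts H Fs′ →
                  DisjointForts (G □ H) (cartesianProductWith _⊠_ Fs Fs′)
DisjointForts-⊠ {G} {H} {Fs} {Fs′} (forts , disjoint) (forts′ , disjoint′) =
  All.cartesianProductWith⁺ (≡.setoid _) (≡.setoid _) _⊠_ Fs Fs′
    (λ F∈ F′∈ → ⊠-fort {G} {H} (All.lookup forts F∈) (All.lookup forts′ F′∈)) ,
  AllPairs-cartesianProductWith⁺ _⊠_
    (λ {F₁ F₂ F₁′ F₂′} → ⊠-disjointˡ {F₁ = F₁} {F₂} {F₁′} {F₂′})
    (λ {F} {F₁′ F₂′} → ⊠-disjointʳ {F₁ = F} {F} {F₁′} {F₂′})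
    disjoint disjoint′

-- Complete graphs

Adj-K⁺ : ∀ {N} {u v : Fin N} → u ≢ v → Adj (K N) u v
Adj-K⁺ u≢v = cong not (eqB-false u≢v)

module _ {N} {F : Subset N} where

  K-fort : ∀ {x y} → x ≢ y → x ∈ F → y ∈ F → IsFort (K N) F
  K-fort x≢y x∈F y∈F = fort-intro {K N} (_ , x∈F) λ v∉F (_ , _ , unique) →
    x≢y (trans (unique x∈F (Adj-K⁺ (apart v∉F x∈F))) (sym (unique y∈F (Adj-K⁺ (apart v∉F y∈F)))))
    where
    apart : ∀ {v w} → v ∉ F → w ∈ F → v ≢ w
    apart v∉F w∈F refl = v∉F w∈F

  K-fort⇒2≤∣F∣ : 2 ≤ N → IsFort (K N) F → 2 ≤ ∣ F ∣
  K-fort⇒2≤∣F∣ (s≤s (s≤s _)) fort@((x , x∈F) , _) with punchIn x Fin.zero ∈? F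
  ... | yes y∈F = length≤∣p∣ ((punchInᵢ≢i x Fin.zero ∷ []) ∷ [] ∷ []) (y∈F ∷ x∈F ∷ [])
  ... | no y∉F =
    let w , w∈F , _ , w≢x = fort⇒secondNeighbour {K N} fort y∉F x∈F (Adj-K⁺ (punchInᵢ≢i x Fin.zero))
    in length≤∣p∣ ((w≢x ∷ []) ∷ [] ∷ []) (w∈F ∷ x∈F ∷ [])

module _ (m : ℕ) where

  -- Fin (2 * m) is read as Fin 2 × Fin m through combine, and pair i is {(0, i), (1, i)}.
  pairIndex : Fin (2 * m) → Fin m
  pairIndex x = proj₂ (remQuot {2} m x)

  pair : Fin m → Subset (2 * m)
  pair i = tabulate λ x → eqB (pairIndex x) i

  combine∈pair : ∀ (c : Fin 2) i → combine c i ∈ pair i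
  combine∈pair c i = ∈-tabulate⁺ {f = λ x → eqB (pairIndex x) i}
    (trans (cong (λ x → eqB x i) (cong proj₂ (remQuot-combine c i))) (eqB-refl i))

  pair-disjoint : ∀ {i j} → i ≢ j → Disjoint (pair i) (pair j)
  pair-disjoint {i} {j} i≢j = Disjoint⁺ λ x∈i x∈j →
    i≢j (trans (sym (eqB-true⁻ (∈-tabulate⁻ {f = λ x → eqB (pairIndex x) i} x∈i)))
                    (eqB-true⁻ (∈-tabulate⁻ {f = λ x → eqB (pairIndex x) j} x∈j)))

  pair-fort : ∀ i → IsFort (K (2 * m)) (pair i)
  pair-fort i =
    K-fort (λ eq → contradiction (combine-injectiveˡ {2} Fin.zero i (Fin.suc Fin.zero) i eq) λ ())
    (combine∈pair Fin.zero i) (combine∈pair (Fin.suc Fin.zero) i)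

  pairForts : List (Subset (2 * m))
  pairForts = List.tabulate pair

  pairForts-disjointForts : DisjointForts (K (2 * m)) pairForts
  pairForts-disjointForts = All.tabulate⁺ pair-fort , AllPairs.tabulate⁺ pair-disjoint

-- Forts of the rook's graph

-- pos is a coordinate system on K N □ K N in which the first coordinate indexes rows; it is
-- instantiated with both combine and flip combine, so the argument serves rows and columns alike.
module RookLines {N} (F : Subset (N * N)) (fort : IsFort (K N □ K N) F)
  (pos : Fin N → Fin N → Fin (N * N))
  (pos-injectiveʳ : ∀ {a b c d} → pos a b ≡ pos c d → b ≡ d)
  (pos-surjective : ∀ x → ∃ λ ((a , b) : Fin N × Fin N) → pos a b ≡ x)
  (Adj-pos⁺ : ∀ {a b d} → b ≢ d → Adj (K N □ K N) (pos a b) (pos a d))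
  (Adj-pos⁻ : ∀ {a b c d} → Adj (K N □ K N) (pos a b) (pos c d) → a ≡ c ⊎ b ≡ d)
  where

  aloneInRow⇒everyColumnMeetsF : ∀ {a b} → pos a b ∈ F → (∀ {d} → pos a d ∈ F → d ≡ b) →
                                 ∀ c → ∃ λ r → pos r c ∈ F
  aloneInRow⇒everyColumnMeetsF {a} {b} ab∈F alone c with c ≟ b
  ... | yes refl = a , ab∈F
  ... | no c≢b
    with fort⇒secondNeighbour {K N □ K N} fort (λ ac∈F → c≢b (alone ac∈F)) ab∈F (Adj-pos⁺ c≢b)
  ... | w , w∈F , ac∼w , w≢ab with pos-surjective w
  ... | (r , d) , refl with Adj-pos⁻ ac∼w
  ... | inj₁ refl = contradiction (cong (pos a) (alone w∈F)) w≢ab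
  ... | inj₂ refl = r , w∈F

  secondInRow⊎N≤∣F∣ : ∀ {a b} → pos a b ∈ F → (∃ λ d → b ≢ d × pos a d ∈ F) ⊎ N ≤ ∣ F ∣
  secondInRow⊎N≤∣F∣ {a} {b} ab∈F with any? (λ d → ¬? (b ≟ d) ×-dec (pos a d ∈? F))
  ... | yes second = inj₁ second
  ... | no noSecond =
    inj₂ (injection⇒≤∣p∣ (λ c → pos (proj₁ (meets c)) c) pos-injectiveʳ (proj₂ ∘ meets))
    where
    meets = aloneInRow⇒everyColumnMeetsF ab∈F λ {d} ad∈F →
      sym (decidable-stable (b ≟ d) λ b≢d → noSecond (d , b≢d , ad∈F))

module _ {N} {F : Subset (N * N)} (fort : IsFort (K N □ K N) F) where

  private
    rowApart : ∀ {a b c d : Fin N} → a ≢ c → combine a b ≢ combine c d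
    rowApart {a} {b} {c} {d} a≢c = a≢c ∘ combine-injectiveˡ a b c d

    columnApart : ∀ {a b c d : Fin N} → b ≢ d → combine a b ≢ combine c d
    columnApart {a} {b} {c} {d} b≢d = b≢d ∘ combine-injectiveʳ a b c d

    Adj-rook⁻ : ∀ {a b c d} → Adj (K N □ K N) (combine a b) (combine c d) → a ≡ c ⊎ b ≡ d
    Adj-rook⁻ = Sum.map proj₁ proj₁ ∘ Adj-□⁻ {K N} {K N}

    module Rows = RookLines F fort combine
      (λ {a} {b} {c} {d} → combine-injectiveʳ a b c d)
      (λ x → remQuot {N} N x , combine-remQuot {N} N x)
      (λ b≢d → Adj-□⁺ʳ {K N} {K N} (Adj-K⁺ b≢d))
      Adj-rook⁻

    module Columns = RookLines F fort (flip combine)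
      (λ {a} {b} {c} {d} → combine-injectiveˡ b a d c)
      (λ x → Product.swap (remQuot {N} N x) , combine-remQuot {N} N x)
      (λ b≢d → Adj-□⁺ˡ {K N} {K N} (Adj-K⁺ b≢d))
      (Sum.swap ∘ Adj-rook⁻)

  rookFort⇒4≤∣F∣ : 4 ≤ N → 4 ≤ ∣ F ∣
  rookFort⇒4≤∣F∣ 4≤N with proj₁ fort
  ... | x , x∈F with coordinates {N} {N} x
  ... | coords a b with Rows.secondInRow⊎N≤∣F∣ x∈F
  ... | inj₂ N≤∣F∣ = ≤-trans 4≤N N≤∣F∣
  ... | inj₁ (b′ , b≢b′ , ab′∈F) with Columns.secondInRow⊎N≤∣F∣ x∈F
  ... | inj₂ N≤∣F∣ = ≤-trans 4≤N N≤∣F∣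
  ... | inj₁ (a′ , a≢a′ , a′b∈F) with Rows.secondInRow⊎N≤∣F∣ a′b∈F
  ... | inj₂ N≤∣F∣ = ≤-trans 4≤N N≤∣F∣
  ... | inj₁ (b″ , b≢b″ , a′b″∈F) =
    length≤∣p∣ ((columnApart b≢b′ ∷ rowApart a≢a′ ∷ rowApart a≢a′ ∷ [])
               ∷ (rowApart a≢a′ ∷ rowApart a≢a′ ∷ [])
               ∷ (columnApart b≢b″ ∷ [])
               ∷ [] ∷ [])
               (x∈F ∷ ab′∈F ∷ a′b∈F ∷ a′b″∈F ∷ [])

proposition4p14 : (m : ℕ) → 2 ≤ m →
    ((F : Subset (n (K (2 * m) □ K (2 * m)))) →
    IsFort (K (2 * m) □ K (2 * m)) F → 4 ≤ ∣ F ∣)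
    × ∃ (λ k → IsFortNumber (K (2 * m)) k
    × IsFortNumber (K (2 * m) □ K (2 * m)) (k * k))
proposition4p14 m 2≤m = rookForts-large , m , K-fortNumber , rook-fortNumber
  where
  N = 2 * m

  rookForts-large : ∀ F → IsFort (K N □ K N) F → 4 ≤ ∣ F ∣
  rookForts-large F fort = rookFort⇒4≤∣F∣ fort (*-monoʳ-≤ 2 2≤m)

  K-fortNumber : IsFortNumber (K N) m
  K-fortNumber = IsFortNumber-intro {K N} 2 (pairForts m)
    (λ F → K-fort⇒2≤∣F∣ (≤-trans 2≤m (m≤m+n m _))) ≤-refl
    (pairForts-disjointForts m) (length-tabulate (pair m))

  rook-fortNumber : IsFortNumber (K N □ K N) (m * m)
  rook-fortNumber =
    IsFortNumber-intro {K N □ K N} 4 (cartesianProductWith _⊠_ (pairForts m) (pairForts m))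
    rookForts-large (≤-reflexive (square-double m))
    (DisjointForts-⊠ {K N} {K N} (pairForts-disjointForts m) (pairForts-disjointForts m))
    (trans (length-cartesianProductWith _⊠_ (pairForts m) (pairForts m))
           (cong₂ _*_ (length-tabulate (pair m)) (length-tabulate (pair m))))
    where
    square-double : ∀ m → (2 * m) * (2 * m) ≡ 4 * (m * m)
    square-double = solve-∀
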